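{- Let $T$ be a tree with $m$ vertices and let $G$ be a graph with a locally $k$-bounded edge-colouring and minimum degree $\delta(G)\geq 3km$. Then $G$ contains a rainbow copy of $T$.
   Context: An edge-colouring is locally $k$-bounded if every vertex is contained in at most $k$ edges of any one colour. A subgraph is rainbow if its edges have pairwise distinct colours. -}

module Defs where

open import Data.Nat using (ℕ; zero; suc; _≤_; _*_; _+_)
open import Data.Fin using (Fin)
open import Data.Bool using (Bool; true; false; T)
open import Data.List using (List; []; _∷_; filter; length)
open import Data.List.Relation.Unary.Unique.Propositional using (Unique)
open import Data.Product using (Σ; _×_; _,_; ∃)
open import Data.Sum using (_⊎_)
open import Data.Fin.Base using (toℕ)
open import Data.Vec.Functional using (Vector)
open import Data.Fin using (_≟_)
open import Relation.Nullary using (¬_; Dec)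
open import Relation.Binary.PropositionalEquality using (_≡_)
open import Data.List.Base using (allFin)
open import Relation.Nullary.Decidable using (does)
import Data.Nat as ℕ

record Graph (n : ℕ) : Set where
  field
    adj   : Fin n → Fin n → Bool
    sym   : ∀ u v → adj u v ≡ adj v u
    irrefl : ∀ v → adj v v ≡ false

open Graph public

Edge : ∀ {n} → Graph n → Fin n → Fin n → Set
Edge G u v = T (adj G u v)

neighbours : ∀ {n} → Graph n → Fin n → List (Fin n)
neighbours {n} G v = filter (λ u → Data.Bool._≟_ (adj G v u) true) (allFin n)

degree : ∀ {n} → Graph n → Fin n → ℕ
degree G v = length (neighbours G v)

MinDegreeAtLeast : ∀ {n} → Graph n → ℕ → Set
MinDegreeAtLeast {n} G d = ∀ (v : Fin n) → d ≤ degree G v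

-- An edge-colouring with colours in ℕ: a symmetric function on pairs of
-- vertices (its values on non-edges are irrelevant).
record EdgeColouring {n} (G : Graph n) : Set where
  field
    col    : Fin n → Fin n → ℕ
    colSym : ∀ u v → col u v ≡ col v u

open EdgeColouring public

LocallyBounded : ∀ {n} {G : Graph n} → ℕ → EdgeColouring G → Set
LocallyBounded {n} {G} k c =
  ∀ (v : Fin n) (a : ℕ) →
    length (filter (λ u → ℕ._≟_ (col c v u) a) (neighbours G v)) ≤ k

data Walk {n} (G : Graph n) : Fin n → Fin n → Set where
  here : ∀ {v} → Walk G v v
  step : ∀ {u v w} → Edge G u v → Walk G v w → Walk G u w

Connected : ∀ {n} → Graph n → Set
Connected {n} G = ∀ (u v : Fin n) → Walk G u v

Path : ∀ {n} → Graph n → List (Fin n) → Set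
Path G [] = Data.Unit.⊤
  where import Data.Unit
Path G (v ∷ []) = Data.Unit.⊤
  where import Data.Unit
Path G (u ∷ v ∷ vs) = Edge G u v × Path G (v ∷ vs)

last : ∀ {A : Set} → A → List A → A
last a [] = a
last a (b ∷ bs) = last b bs

HasCycle : ∀ {n} → Graph n → Set
HasCycle {n} G =
  Σ (Fin n) λ v0 → Σ (List (Fin n)) λ vs →
    2 ≤ length vs × Unique (v0 ∷ vs) × Path G (v0 ∷ vs) × Edge G (last v0 vs) v0

IsTree : ∀ {m} → Graph m → Set
IsTree {m} T' = 1 ≤ m × Connected T' × ¬ HasCycle T'

-- A rainbow copy of H in G (w.r.t. colouring c): an injective map of
-- vertices preserving adjacency, such that distinct edges of H are mapped
-- to edges of distinct colours.
RainbowCopy : ∀ {m n} (H : Graph m) (G : Graph n) → EdgeColouring G → Set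
RainbowCopy {m} {n} H G c =
  Σ (Fin m → Fin n) λ f →
    (∀ i j → f i ≡ f j → i ≡ j) ×
    (∀ i j → Edge H i j → Edge G (f i) (f j)) ×
    (∀ i j i' j' → Edge H i j → Edge H i' j' →
       col c (f i) (f j) ≡ col c (f i') (f j') →
       (i ≡ i' × j ≡ j') ⊎ (i ≡ j' × j ≡ i'))

module Submission where

-- The copy is grown greedily along a subtree S of T rooted at r, attaching one new vertex v at a
-- time. Acyclicity forces v to have exactly one neighbour p in the connected subtree S, so the only
-- new edge of the copy is the one at the image of p. Among the at least 3km neighbours of that
-- image, at most |S| ≤ m are already used as images, and by local k-boundedness at most k·|S| ≤ km
-- are joined to it by a colour already used on the copy; this leaves a valid image for v.

open import Defs hiding (sym)
open import Level using (0ℓ)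
open import Data.Bool using (T; true; false)
import Data.Bool as Bool
open import Data.Unit using (tt)
open import Data.Nat using (ℕ; zero; suc; _≤_; _<_; _*_; _+_; z≤n; s≤s; z<s)
import Data.Nat as ℕ
open import Data.Nat.Properties
open import Data.Fin using (Fin)
import Data.Fin as Fin
open import Data.Fin.Properties using (all?; ¬∀⟶∃¬)
open import Data.Product using (Σ; ∃-syntax; _×_; _,_; proj₁; proj₂)
import Data.Product as Product
open import Data.Sum using (_⊎_; inj₁; inj₂)
import Data.Sum as Sum
open import Data.List using (List; []; _∷_; filter; length; map; _++_; [_]; allFin)
open import Data.List.Properties using (filter-all; filter-accept; filter-none; length-map; length-tabulate)
open import Data.List.Relation.Unary.Any using (here; there)
open import Data.List.Relation.Unary.All using (All; []; _∷_)
import Data.List.Relation.Unary.All as All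
import Data.List.Relation.Unary.All.Properties as All
open import Data.List.Relation.Unary.AllPairs using ([]; _∷_)
open import Data.List.Relation.Unary.Unique.Propositional using (Unique)
open import Data.List.Relation.Unary.Unique.Propositional.Properties using (filter⁺; allFin⁺; ++⁺)
open import Data.List.Membership.Propositional using (_∈_; _∉_)
open import Data.List.Membership.Propositional.Properties using (∈-filter⁻; ∈-map⁺; ∈-allFin)
import Data.List.Membership.DecPropositional as DecMembership
open import Data.Vec.Functional using (updateAt)
open import Data.Vec.Functional.Properties using (updateAt-updates; updateAt-minimal)
open import Relation.Nullary using (¬_; yes; no; ¬?; _×-dec_; contradiction)
open import Relation.Nullary.Decidable using (does; decidable-stable)
open import Relation.Unary using (Pred; Decidable)
open import Relation.Binary.Definitions using (DecidableEquality)
open import Relation.Binary.PropositionalEquality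
  using (_≡_; _≢_; refl; sym; trans; cong; cong₂; subst; subst₂)

open ≤-Reasoning

length-filter-∷-≥ : ∀ {A : Set} {P : Pred A 0ℓ} (P? : Decidable P) x xs →
  length (filter P? xs) ≤ length (filter P? (x ∷ xs))
length-filter-∷-≥ P? x xs with does (P? x)
... | true  = n≤1+n _
... | false = ≤-refl

module _ {A : Set} {P Q : Pred A 0ℓ} (P? : Decidable P) (Q? : Decidable Q) where

  length-filter-∪-∷ : ∀ {x} xs → P x ⊎ Q x →
    suc (length (filter P? xs) + length (filter Q? xs)) ≤
    length (filter P? (x ∷ xs)) + length (filter Q? (x ∷ xs))
  length-filter-∪-∷ {x} xs (inj₁ px) = begin
    suc (length (filter P? xs) + length (filter Q? xs))
      ≡⟨ cong (λ ys → length ys + length (filter Q? xs)) (filter-accept P? px) ⟨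
    length (filter P? (x ∷ xs)) + length (filter Q? xs)
      ≤⟨ +-monoʳ-≤ _ (length-filter-∷-≥ Q? x xs) ⟩
    length (filter P? (x ∷ xs)) + length (filter Q? (x ∷ xs)) ∎
  length-filter-∪-∷ {x} xs (inj₂ qx) = begin
    suc (length (filter P? xs) + length (filter Q? xs))
      ≡⟨ +-suc _ _ ⟨
    length (filter P? xs) + suc (length (filter Q? xs))
      ≡⟨ cong (λ ys → length (filter P? xs) + length ys) (filter-accept Q? qx) ⟨
    length (filter P? xs) + length (filter Q? (x ∷ xs))
      ≤⟨ +-monoˡ-≤ _ (length-filter-∷-≥ P? x xs) ⟩
    length (filter P? (x ∷ xs)) + length (filter Q? (x ∷ xs)) ∎

  length-filter-⊆-∪ : ∀ {R : Pred A 0ℓ} (R? : Decidable R) → (∀ {x} → R x → P x ⊎ Q x) →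
    ∀ xs →
    length (filter R? xs) ≤ length (filter P? xs) + length (filter Q? xs)
  length-filter-⊆-∪ R? R⊆P∪Q [] = z≤n
  length-filter-⊆-∪ R? R⊆P∪Q (x ∷ xs) with R? x
  ... | yes rx = ≤-trans (s≤s (length-filter-⊆-∪ R? R⊆P∪Q xs))
                   (length-filter-∪-∷ xs (R⊆P∪Q rx))
  ... | no _   = ≤-trans (length-filter-⊆-∪ R? R⊆P∪Q xs)
                   (+-mono-≤ (length-filter-∷-≥ P? x xs) (length-filter-∷-≥ Q? x xs))

  ∃-avoiding-filters : ∀ xs → length (filter P? xs) + length (filter Q? xs) < length xs →
    ∃[ x ] x ∈ xs × ¬ P x × ¬ Q x
  ∃-avoiding-filters (x ∷ xs) fewer with ¬? (P? x) ×-dec ¬? (Q? x)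
  ... | yes (¬px , ¬qx) = x , here refl , ¬px , ¬qx
  ... | no ¬avoids with ∃-avoiding-filters xs
         (≤-pred (≤-trans (s≤s (length-filter-∪-∷ xs (P⊎Q ¬avoids))) fewer))
    where
      P⊎Q : ¬ (¬ P x × ¬ Q x) → P x ⊎ Q x
      P⊎Q ¬avoids with P? x | Q? x
      ... | yes px | _      = inj₁ px
      ... | no _   | yes qx = inj₂ qx
      ... | no ¬px | no ¬qx = contradiction (¬px , ¬qx) ¬avoids
  ... | y , y∈ , ¬py , ¬qy = y , there y∈ , ¬py , ¬qy

module _ {A B : Set} (_≟_ : DecidableEquality B) (g : A → B) where
  open DecMembership _≟_ using (_∈?_)

  length-filter-∈-≤ : ∀ {k} xs → (∀ b → length (filter (λ x → g x ≟ b) xs) ≤ k) →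
    ∀ bs → length (filter (λ x → g x ∈? bs) xs) ≤ k * length bs
  length-filter-∈-≤ {k} xs fibre≤k [] = begin
    length (filter (λ x → g x ∈? []) xs)  ≡⟨ cong length (filter-none _ {xs} (All.tabulate λ _ ())) ⟩
    0                                     ≤⟨ z≤n ⟩
    k * 0                                 ∎
  length-filter-∈-≤ {k} xs fibre≤k (b ∷ bs) = begin
    length (filter (λ x → g x ∈? (b ∷ bs)) xs)
      ≤⟨ length-filter-⊆-∪ (λ x → g x ≟ b) (λ x → g x ∈? bs) (λ x → g x ∈? (b ∷ bs))
           (λ { (here gx≡b) → inj₁ gx≡b ; (there gx∈bs) → inj₂ gx∈bs }) xs ⟩
    length (filter (λ x → g x ≟ b) xs) + length (filter (λ x → g x ∈? bs) xs)
      ≤⟨ +-mono-≤ (fibre≤k b) (length-filter-∈-≤ xs fibre≤k bs) ⟩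
    k + k * length bs
      ≡⟨ *-suc k (length bs) ⟨
    k * length (b ∷ bs) ∎

module _ {A : Set} (_≟_ : DecidableEquality A) where
  open DecMembership _≟_ using (_∈?_)

  Unique⇒length-filter-≟-≤1 : ∀ {xs} → Unique xs → ∀ b → length (filter (_≟ b) xs) ≤ 1
  Unique⇒length-filter-≟-≤1 [] b = z≤n
  Unique⇒length-filter-≟-≤1 {x ∷ xs} (x∉xs ∷ unique) b with x ≟ b
  ... | yes refl = s≤s (≤-reflexive (cong length
                     (filter-none (_≟ x) (All.map (λ x≢y y≡x → x≢y (sym y≡x)) x∉xs))))
  ... | no _     = Unique⇒length-filter-≟-≤1 unique b

  Unique⇒length-≤ : ∀ {xs ys} → Unique xs → (∀ {x} → x ∈ xs → x ∈ ys) →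
    length xs ≤ length ys
  Unique⇒length-≤ {xs} {ys} unique xs⊆ys = begin
    length xs                    ≡⟨ cong length (filter-all (_∈? ys) (All.tabulate xs⊆ys)) ⟨
    length (filter (_∈? ys) xs)  ≤⟨ length-filter-∈-≤ _≟_ (λ x → x) xs
                                      (Unique⇒length-filter-≟-≤1 unique) ys ⟩
    1 * length ys                ≡⟨ *-identityˡ _ ⟩
    length ys                    ∎

module _ {n : ℕ} (H : Graph n) where
  open DecMembership (Fin._≟_ {n}) using (_∈?_)

  edge-sym : ∀ {a b} → Edge H a b → Edge H b a
  edge-sym {a} {b} = subst T (Graph.sym H a b)

  edge-irrefl : ∀ {a} → ¬ Edge H a a
  edge-irrefl {a} = subst T (irrefl H a)

  ∈-neighbours⇒Edge : ∀ {w u} → u ∈ neighbours H w → Edge H w u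
  ∈-neighbours⇒Edge {w} {u} u∈ =
    subst T (sym (proj₂ (∈-filter⁻ (λ u → adj H w u Bool.≟ true) {xs = allFin n} u∈))) tt

  neighbours-Unique : ∀ w → Unique (neighbours H w)
  neighbours-Unique w = filter⁺ (λ u → adj H w u Bool.≟ true) (allFin⁺ n)

  walk-leaves : ∀ {S x y} → Walk H x y → x ∈ S → y ∉ S →
    ∃[ p ] ∃[ v ] p ∈ S × v ∉ S × Edge H p v
  walk-leaves here x∈S x∉S = contradiction x∈S x∉S
  walk-leaves {S} {x} (step {v = z} xz walk) x∈S y∉S with z ∈? S
  ... | yes z∈S = walk-leaves walk z∈S y∉S
  ... | no z∉S  = x , z , x∈S , z∉S , xz

  Path-snoc : ∀ a xs {v} → Path H (a ∷ xs) → Edge H (last a xs) v → Path H (a ∷ xs ++ [ v ])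
  Path-snoc a []       path      av = av , tt
  Path-snoc a (b ∷ xs) (ab , path) bv = ab , Path-snoc b xs path bv

  last-snoc : ∀ (a : Fin n) xs v → last a (xs ++ [ v ]) ≡ v
  last-snoc a []       v = refl
  last-snoc a (b ∷ xs) v = last-snoc b xs v

  record PathWithin (V : List (Fin n)) (a b : Fin n) : Set where
    field
      tail   : List (Fin n)
      unique : Unique (a ∷ tail)
      path   : Path H (a ∷ tail)
      ends   : last a tail ≡ b
      within : All (_∈ V) (a ∷ tail)

  module _ {V : List (Fin n)} where

    PathWithin-refl : ∀ {a} → a ∈ V → PathWithin V a a
    PathWithin-refl a∈V = record
      { tail = [] ; unique = [] ∷ [] ; path = tt ; ends = refl ; within = a∈V ∷ [] }

    PathWithin-weaken : ∀ {v a b} → PathWithin V a b → PathWithin (v ∷ V) a b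
    PathWithin-weaken p = record { PathWithin p ; within = All.map there (PathWithin.within p) }

    ∉-PathWithin : ∀ {v a b} → v ∉ V → (p : PathWithin V a b) →
      All (v ≢_) (a ∷ PathWithin.tail p)
    ∉-PathWithin v∉V p =
      All.map (λ x∈V v≡x → v∉V (subst (_∈ V) (sym v≡x) x∈V)) (PathWithin.within p)

    PathWithin-cons : ∀ {v a b} → v ∉ V → Edge H v a → PathWithin V a b →
      PathWithin (v ∷ V) v b
    PathWithin-cons {v} {a} v∉V va p = record
      { tail   = a ∷ tail
      ; unique = ∉-PathWithin v∉V p ∷ unique
      ; path   = va , path
      ; ends   = ends
      ; within = here refl ∷ All.map there within }
      where open PathWithin p

    PathWithin-snoc : ∀ {v a b} → v ∉ V → PathWithin V a b → Edge H b v →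
      PathWithin (v ∷ V) a v
    PathWithin-snoc {v} {a} v∉V p bv = record
      { tail   = tail ++ [ v ]
      ; unique = ++⁺ unique ([] ∷ [])
                   (λ { (x∈ , here refl) → All.lookup (∉-PathWithin v∉V p) x∈ refl })
      ; path   = Path-snoc a tail path (subst (λ x → Edge H x v) (sym ends) bv)
      ; ends   = last-snoc a tail v
      ; within = All.++⁺ (All.map there within) (here refl ∷ []) }
      where open PathWithin p

    fork⇒cycle : ∀ {v p q} → v ∉ V → p ≢ q → Edge H v p → Edge H v q → PathWithin V p q →
      HasCycle H
    fork⇒cycle v∉V p≢q vp vq record { tail = [] ; ends = p≡q } = contradiction p≡q p≢q
    fork⇒cycle {v} {p} v∉V p≢q vp vq
               pq@record { tail = z ∷ zs ; unique = unique ; path = path ; ends = ends } =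
      v , p ∷ z ∷ zs , s≤s (s≤s z≤n) , ∉-PathWithin v∉V pq ∷ unique , (vp , path) ,
      subst (λ x → Edge H x v) (sym ends) (edge-sym vq)

    acyclic⇒attached-once : ¬ HasCycle H → ∀ {v p q} → v ∉ V →
      Edge H v p → Edge H v q → PathWithin V p q → p ≡ q
    acyclic⇒attached-once acyclic {p = p} {q} v∉V vp vq pq =
      decidable-stable (p Fin.≟ q) (λ p≢q → acyclic (fork⇒cycle v∉V p≢q vp vq pq))

fresh-neighbour : ∀ {n k} {G : Graph n} {c : EdgeColouring G} → LocallyBounded k c →
  ∀ w (U : List (Fin n)) (Cs : List ℕ) → length U + k * length Cs < degree G w →
  ∃[ u ] Edge G w u × u ∉ U × col c w u ∉ Cs
fresh-neighbour {n} {k} {G} {c} bounded w U Cs small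
  with ∃-avoiding-filters (_∈? U) (λ u → col c w u ∈ℕ? Cs) (neighbours G w) few-bad
  where
    open DecMembership (Fin._≟_ {n}) using (_∈?_)
    open DecMembership ℕ._≟_ using () renaming (_∈?_ to _∈ℕ?_)
    N = neighbours G w
    few-bad : length (filter (_∈? U) N) + length (filter (λ u → col c w u ∈ℕ? Cs) N) < length N
    few-bad = begin-strict
      length (filter (_∈? U) N) + length (filter (λ u → col c w u ∈ℕ? Cs) N)
        ≤⟨ +-mono-≤ (length-filter-∈-≤ Fin._≟_ (λ u → u) N
                       (Unique⇒length-filter-≟-≤1 Fin._≟_ (neighbours-Unique G w)) U)
                    (length-filter-∈-≤ ℕ._≟_ (col c w) N (bounded w) Cs) ⟩
      1 * length U + k * length Cs
        ≡⟨ cong (_+ k * length Cs) (*-identityˡ _) ⟩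
      length U + k * length Cs
        <⟨ small ⟩
      length N ∎
... | u , u∈N , u∉U , cu∉Cs = u , ∈-neighbours⇒Edge G u∈N , u∉U , cu∉Cs

greedy-bound : ∀ {k s m} → 1 ≤ k → 1 ≤ s → s ≤ m → s + k * s < 3 * k * m
greedy-bound {k} {s} {m} k≥1 s≥1 s≤m = begin-strict
  s + k * s       ≤⟨ +-mono-≤ (≤-trans s≤m m≤km) (*-monoʳ-≤ k s≤m) ⟩
  km + km         <⟨ +-monoʳ-< km (m<m+n km km≥1) ⟩
  km + (km + km)  ≡⟨ cong (λ x → km + (km + x)) (+-identityʳ km) ⟨
  3 * km          ≡⟨ *-assoc 3 k m ⟨
  3 * k * m       ∎
  where
    km = k * m
    m≤km : m ≤ km
    m≤km = ≤-trans (≤-reflexive (sym (*-identityˡ m))) (*-monoˡ-≤ m k≥1)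
    km≥1 : 1 ≤ km
    km≥1 = ≤-trans (≤-trans s≥1 s≤m) m≤km

module Subtrees {m : ℕ} (T : Graph m) (acyclic : ¬ HasCycle T) (r : Fin m) where

  record Subtree : Set where
    field
      V           : List (Fin m)
      V-unique    : Unique V
      root∈V      : r ∈ V
      parent      : Fin m → Fin m
      parent∈V    : ∀ {a} → a ∈ V → a ≢ r → parent a ∈ V
      connected   : ∀ {a b} → a ∈ V → b ∈ V → PathWithin T V a b
      edge⇒parent : ∀ {a b} → a ∈ V → b ∈ V → Edge T a b →
                    (a ≢ r × b ≡ parent a) ⊎ (b ≢ r × a ≡ parent b)

  record RainbowEmbedding {n : ℕ} (G : Graph n) (c : EdgeColouring G) (S : Subtree) : Set where
    open Subtree S
    field
      f            : Fin m → Fin n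
      f-injective  : ∀ {a b} → a ∈ V → b ∈ V → f a ≡ f b → a ≡ b
      parent-edges : ∀ {a} → a ∈ V → a ≢ r → Edge G (f a) (f (parent a))
      rainbow      : ∀ {a b} → a ∈ V → b ∈ V → a ≢ r → b ≢ r →
                     col c (f a) (f (parent a)) ≡ col c (f b) (f (parent b)) → a ≡ b

    colour : Fin m → ℕ
    colour a = col c (f a) (f (parent a))

  root-subtree : Subtree
  root-subtree = record
    { V           = [ r ]
    ; V-unique    = [] ∷ []
    ; root∈V      = here refl
    ; parent      = λ a → a
    ; parent∈V    = λ { (here a≡r) a≢r → contradiction a≡r a≢r }
    ; connected   = λ { (here refl) (here refl) → PathWithin-refl T (here refl) }
    ; edge⇒parent = λ { (here refl) (here refl) rr → contradiction rr (edge-irrefl T) }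
    }

  root-embedding : ∀ {n} {G : Graph n} {c : EdgeColouring G} → Fin n → RainbowEmbedding G c root-subtree
  root-embedding z = record
    { f            = λ _ → z
    ; f-injective  = λ { (here refl) (here refl) _ → refl }
    ; parent-edges = λ { (here a≡r) a≢r → contradiction a≡r a≢r }
    ; rainbow      = λ { (here a≡r) _ a≢r _ _ → contradiction a≡r a≢r }
    }

  Subtree-size : (S : Subtree) → 1 ≤ length (Subtree.V S) × length (Subtree.V S) ≤ m
  Subtree-size S = nonempty root∈V , (begin
    length V          ≤⟨ Unique⇒length-≤ Fin._≟_ V-unique (λ {x} _ → ∈-allFin x) ⟩
    length (allFin m) ≡⟨ length-tabulate (λ x → x) ⟩
    m                 ∎)
    where
      open Subtree S
      nonempty : ∀ {x : Fin m} {xs} → x ∈ xs → 1 ≤ length xs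
      nonempty (here _)  = s≤s z≤n
      nonempty (there _) = s≤s z≤n

  module Attach (S : Subtree) {v p : Fin m} (v∉V : v ∉ Subtree.V S) (p∈V : p ∈ Subtree.V S)
                (pv : Edge T p v) where
    open Subtree S

    ∈V⇒≢v : ∀ {a} → a ∈ V → a ≢ v
    ∈V⇒≢v a∈V refl = v∉V a∈V

    v≢r : v ≢ r
    v≢r refl = v∉V root∈V

    parent′ : Fin m → Fin m
    parent′ = updateAt parent v (λ _ → p)

    parent′-new : parent′ v ≡ p
    parent′-new = updateAt-updates v parent

    parent′-old : ∀ {a} → a ∈ V → parent′ a ≡ parent a
    parent′-old a∈V = updateAt-minimal _ v parent (∈V⇒≢v a∈V)

    attached-at-p : ∀ {q} → q ∈ V → Edge T v q → q ≡ p
    attached-at-p q∈V vq =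
      sym (acyclic⇒attached-once T acyclic v∉V (edge-sym T pv) vq (connected p∈V q∈V))

    subtree : Subtree
    subtree = record
      { V           = v ∷ V
      ; V-unique    = All.tabulate (λ a∈V v≡a → ∈V⇒≢v a∈V (sym v≡a)) ∷ V-unique
      ; root∈V      = there root∈V
      ; parent      = parent′
      ; parent∈V    = λ
          { (here refl) _   → subst (_∈ v ∷ V) (sym parent′-new) (there p∈V)
          ; (there a∈V) a≢r →
              subst (_∈ v ∷ V) (sym (parent′-old a∈V)) (there (parent∈V a∈V a≢r)) }
      ; connected   = connected′
      ; edge⇒parent = edge⇒parent′
      }
      where
        connected′ : ∀ {a b} → a ∈ v ∷ V → b ∈ v ∷ V → PathWithin T (v ∷ V) a b
        connected′ (here refl) (here refl) = PathWithin-refl T (here refl)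
        connected′ (here refl) (there b∈V) =
          PathWithin-cons T v∉V (edge-sym T pv) (connected p∈V b∈V)
        connected′ (there a∈V) (here refl) = PathWithin-snoc T v∉V (connected a∈V p∈V) pv
        connected′ (there a∈V) (there b∈V) = PathWithin-weaken T (connected a∈V b∈V)

        edge⇒parent′ : ∀ {a b} → a ∈ v ∷ V → b ∈ v ∷ V → Edge T a b →
                       (a ≢ r × b ≡ parent′ a) ⊎ (b ≢ r × a ≡ parent′ b)
        edge⇒parent′ (here refl) (here refl) vv = contradiction vv (edge-irrefl T)
        edge⇒parent′ (here refl) (there b∈V) vb =
          inj₁ (v≢r , trans (attached-at-p b∈V vb) (sym parent′-new))
        edge⇒parent′ (there a∈V) (here refl) av =
          inj₂ (v≢r , trans (attached-at-p a∈V (edge-sym T av)) (sym parent′-new))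
        edge⇒parent′ (there a∈V) (there b∈V) ab =
          Sum.map (Product.map₂ (λ b≡pa → trans b≡pa (sym (parent′-old a∈V))))
                  (Product.map₂ (λ a≡pb → trans a≡pb (sym (parent′-old b∈V))))
                  (edge⇒parent a∈V b∈V ab)

    module _ {n : ℕ} {G : Graph n} {c : EdgeColouring G} (E : RainbowEmbedding G c S) {u : Fin n}
             (pu : Edge G (RainbowEmbedding.f E p) u)
             (u∉fV : u ∉ map (RainbowEmbedding.f E) V)
             (pu∉colours : col c (RainbowEmbedding.f E p) u ∉ map (RainbowEmbedding.colour E) V) where
      open RainbowEmbedding E

      f′ : Fin m → Fin n
      f′ = updateAt f v (λ _ → u)

      f′-new : f′ v ≡ u
      f′-new = updateAt-updates v f

      f′-old : ∀ {a} → a ∈ V → f′ a ≡ f a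
      f′-old a∈V = updateAt-minimal _ v f (∈V⇒≢v a∈V)

      colour′-new : col c (f′ v) (f′ (parent′ v)) ≡ col c (f p) u
      colour′-new =
        trans (cong₂ (col c) f′-new (trans (cong f′ parent′-new) (f′-old p∈V))) (colSym c u (f p))

      colour′-old : ∀ {a} → a ∈ V → a ≢ r → col c (f′ a) (f′ (parent′ a)) ≡ colour a
      colour′-old a∈V a≢r =
        cong₂ (col c) (f′-old a∈V)
          (trans (cong f′ (parent′-old a∈V)) (f′-old (parent∈V a∈V a≢r)))

      image-fresh : ∀ {a} → a ∈ V → f′ a ≢ f′ v
      image-fresh a∈V fa≡fv = u∉fV
        (subst (_∈ map f V) (trans (sym (f′-old a∈V)) (trans fa≡fv f′-new)) (∈-map⁺ f a∈V))

      colour-fresh : ∀ {a} → a ∈ V → a ≢ r →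
        col c (f′ a) (f′ (parent′ a)) ≢ col c (f′ v) (f′ (parent′ v))
      colour-fresh a∈V a≢r same = pu∉colours
        (subst (_∈ map colour V) (trans (sym (colour′-old a∈V a≢r)) (trans same colour′-new))
               (∈-map⁺ colour a∈V))

      embedding : RainbowEmbedding G c subtree
      embedding = record
        { f            = f′
        ; f-injective  = λ
            { (here refl) (here refl) _   → refl
            ; (here refl) (there b∈V) fvb → contradiction (sym fvb) (image-fresh b∈V)
            ; (there a∈V) (here refl) fav → contradiction fav (image-fresh a∈V)
            ; (there a∈V) (there b∈V) fab →
                f-injective a∈V b∈V (trans (sym (f′-old a∈V)) (trans fab (f′-old b∈V))) }
        ; parent-edges = λ
            { (here refl) _ → subst₂ (Edge G) (sym f′-new)
                (sym (trans (cong f′ parent′-new) (f′-old p∈V))) (edge-sym G pu)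
            ; (there a∈V) a≢r → subst₂ (Edge G) (sym (f′-old a∈V))
                (sym (trans (cong f′ (parent′-old a∈V)) (f′-old (parent∈V a∈V a≢r))))
                (parent-edges a∈V a≢r) }
        ; rainbow      = λ
            { (here refl) (here refl) _ _ _ → refl
            ; (here refl) (there b∈V) _ b≢r cvb → contradiction (sym cvb) (colour-fresh b∈V b≢r)
            ; (there a∈V) (here refl) a≢r _ cav → contradiction cav (colour-fresh a∈V a≢r)
            ; (there a∈V) (there b∈V) a≢r b≢r cab → rainbow a∈V b∈V a≢r b≢r
                (trans (sym (colour′-old a∈V a≢r)) (trans cab (colour′-old b∈V b≢r))) }
        }

  module _ {n k : ℕ} {G : Graph n} {c : EdgeColouring G} (T-connected : Connected T) (k≥1 : 1 ≤ k)
           (bounded : LocallyBounded k c) (min-degree : MinDegreeAtLeast G (3 * k * m)) where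
    open DecMembership (Fin._≟_ {m}) using (_∈?_)

    grow-step : ∀ S → RainbowEmbedding G c S → ∀ {x} → x ∉ Subtree.V S →
      Σ Subtree λ S′ → RainbowEmbedding G c S′ × length (Subtree.V S′) ≡ suc (length (Subtree.V S))
    grow-step S E x∉V with walk-leaves T (T-connected r _) (Subtree.root∈V S) x∉V
    ... | p , v , p∈V , v∉V , pv
      with fresh-neighbour {G = G} {c = c} bounded (f p) (map f V) (map colour V) few-used
      where
        open Subtree S
        open RainbowEmbedding E
        -- `colour r` is junk (the root has no parent edge); counting it only excludes more candidates.
        few-used : length (map f V) + k * length (map colour V) < degree G (f p)
        few-used = begin-strict
          length (map f V) + k * length (map colour V)
            ≡⟨ cong₂ (λ a b → a + k * b) (length-map f V) (length-map colour V) ⟩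
          length V + k * length V
            <⟨ greedy-bound k≥1 (proj₁ (Subtree-size S)) (proj₂ (Subtree-size S)) ⟩
          3 * k * m
            ≤⟨ min-degree (f p) ⟩
          degree G (f p) ∎
    ... | u , pu , u∉fV , pu∉colours =
      Attach.subtree S v∉V p∈V pv , Attach.embedding S v∉V p∈V pv E pu u∉fV pu∉colours , refl

    grow : ∀ fuel S → RainbowEmbedding G c S → m < fuel + length (Subtree.V S) →
      Σ Subtree λ S → RainbowEmbedding G c S × (∀ x → x ∈ Subtree.V S)
    grow fuel S E enough with all? (λ x → x ∈? Subtree.V S)
    ... | yes spanning = S , E , spanning
    ... | no ¬spanning with ¬∀⟶∃¬ m _ (λ x → x ∈? Subtree.V S) ¬spanning
    grow zero       S E enough | no _ | _ = contradiction (proj₂ (Subtree-size S)) (<⇒≱ enough)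
    grow (suc fuel) S E enough | no _ | x , x∉V with grow-step S E x∉V
    ... | S′ , E′ , grown = grow fuel S′ E′
           (subst (m <_) (trans (sym (+-suc fuel _)) (cong (fuel +_) (sym grown))) enough)

  spanning⇒RainbowCopy : ∀ {n} {G : Graph n} {c : EdgeColouring G} (S : Subtree) →
    RainbowEmbedding G c S → (∀ x → x ∈ Subtree.V S) → RainbowCopy T G c
  spanning⇒RainbowCopy {G = G} {c} S E spanning =
    f , (λ i j → f-injective (spanning i) (spanning j)) , edges , distinct-colours
    where
      open Subtree S
      open RainbowEmbedding E

      edges : ∀ i j → Edge T i j → Edge G (f i) (f j)
      edges i j ij with edge⇒parent (spanning i) (spanning j) ij
      ... | inj₁ (i≢r , refl) = parent-edges (spanning i) i≢r
      ... | inj₂ (j≢r , refl) = edge-sym G (parent-edges (spanning j) j≢r)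

      distinct-colours : ∀ i j i′ j′ → Edge T i j → Edge T i′ j′ →
        col c (f i) (f j) ≡ col c (f i′) (f j′) → (i ≡ i′ × j ≡ j′) ⊎ (i ≡ j′ × j ≡ i′)
      distinct-colours i j i′ j′ ij i′j′ same
        with edge⇒parent (spanning i) (spanning j) ij | edge⇒parent (spanning i′) (spanning j′) i′j′
      ... | inj₁ (i≢r , refl) | inj₁ (i′≢r , refl) =
        let i≡i′ = rainbow (spanning i) (spanning i′) i≢r i′≢r same
        in inj₁ (i≡i′ , cong parent i≡i′)
      ... | inj₁ (i≢r , refl) | inj₂ (j′≢r , refl) =
        let i≡j′ = rainbow (spanning i) (spanning j′) i≢r j′≢r (trans same (colSym c _ _))
        in inj₂ (i≡j′ , cong parent i≡j′)
      ... | inj₂ (j≢r , refl) | inj₁ (i′≢r , refl) =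
        let j≡i′ = rainbow (spanning j) (spanning i′) j≢r i′≢r (trans (colSym c _ _) same)
        in inj₂ (cong parent j≡i′ , j≡i′)
      ... | inj₂ (j≢r , refl) | inj₂ (j′≢r , refl) =
        let j≡j′ = rainbow (spanning j) (spanning j′) j≢r j′≢r
                     (trans (colSym c _ _) (trans same (colSym c _ _)))
        in inj₁ (cong parent j≡j′ , j≡j′)

proposition10p1 : ∀ {m n : ℕ} (k : ℕ) (T : Graph m) (G : Graph n) (c : EdgeColouring G) →
    IsTree T → 1 ≤ n → 1 ≤ k → LocallyBounded k c →
    MinDegreeAtLeast G (3 * k * m) → RainbowCopy T G c
proposition10p1 {m} k T G c (m≥1 , T-connected , acyclic) n≥1 k≥1 bounded min-degree =
  let S , E , spanning = grow {c = c} T-connected k≥1 bounded min-degree m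
                           root-subtree (root-embedding (Fin.fromℕ< n≥1)) (m<m+n m z<s)
  in spanning⇒RainbowCopy S E spanning
  where open Subtrees T acyclic (Fin.fromℕ< m≥1)
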